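{- For a 2-functor $T:\mathcal V\text{ -cat}\to\mathcal V\text{ -cat}$ the following are equivalent: (1) there exists a unique 2-functor $\overline T:\mathcal V\text{ -mod}\to\mathcal V\text{ -mod}$ such that $\overline T\circ(-)_\diamond=(-)_\diamond\circ T$; (2) $T$ satisfies the Beck–Chevalley Condition.
   Context: $\mathcal V=(\mathcal V_o,\otimes,I,[-,-])$ is a commutative quantale: $\mathcal V_o$ a complete lattice, $\otimes$ commutative associative with unit $I$ preserving joins in each variable, $x\otimes y\le z$ iff $y\le[x,z]$. $\mathcal V$-categories have hom-values $\mathcal A(a,b)\in\mathcal V_o$ with $I\le\mathcal A(a,a)$, $\mathcal A(b,c)\otimes\mathcal A(a,b)\le\mathcal A(a,c)$; $\mathcal V$-functors satisfy $\mathcal A(a,a')\le\mathcal B(fa,fa')$; $f\le g$ iff $I\le\mathcal B(fa,ga)$ for all $a$. $\mathcal V\text{ -cat}$: 2-category of small $\mathcal V$-categories, $\mathcal V$-functors and $\le$; a 2-functor is a functor preserving $\le$. A module $R:\mathcal A\rightsquigarrow\mathcal B$ is a $\mathcal V$-functor $\mathcal B^{op}\otimes\mathcal A\to\mathcal V$; composition $(S\cdot R)(c,a)=\bigvee_bS(c,b)\otimes R(b,a)$, identities hom-functors, pointwise order: the 2-category $\mathcal V\text{ -mod}$. The graph 2-functor $(-)_\diamond$ is identity on objects with $f_\diamond(b,a)=\mathcal B(b,fa)$. A lax square is $p_0:\mathcal P\to\mathcal A$, $p_1:\mathcal P\to\mathcal B$, $f:\mathcal A\to\mathcal C$, $g:\mathcal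 B\to\mathcal C$ with $fp_0\le gp_1$; it is exact if $\mathcal C(fa,gb)=\bigvee_w\mathcal A(a,p_0w)\otimes\mathcal B(p_1w,b)$ for all $a,b$. $T$ satisfies the Beck–Chevalley Condition (BCC) if it sends exact lax squares to exact lax squares. -}

module Defs where

open import Level using (Level; _⊔_; suc)
open import Relation.Binary.PropositionalEquality using (_≡_; refl; sym; trans; cong; cong₂; subst; module ≡-Reasoning)
open import Data.Product using (Σ; _×_; _,_; ∃-syntax)
open import Function.Bundles using (_⇔_; Equivalence)

-- Carrier : Set c, partial order _≤_ (antisymmetric w.r.t. ≡),
-- joins ⋁ of all families indexed by types in Set ℓ ("small" joins);
-- small V-categories below have object types in Set ℓ.

record Quantale (c ℓ : Level) : Set (suc (c ⊔ ℓ)) where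
  infix  4 _≤_
  infixr 7 _⊗_
  field
    Carrier : Set c
    _≤_     : Carrier → Carrier → Set c
    ≤-refl  : ∀ {x} → x ≤ x
    ≤-trans : ∀ {x y z} → x ≤ y → y ≤ z → x ≤ z
    ≤-antisym : ∀ {x y} → x ≤ y → y ≤ x → x ≡ y
    ⋁       : {J : Set ℓ} → (J → Carrier) → Carrier
    ⋁-upper : ∀ {J : Set ℓ} (h : J → Carrier) (j : J) → h j ≤ ⋁ h
    ⋁-least : ∀ {J : Set ℓ} (h : J → Carrier) (z : Carrier) →
              (∀ j → h j ≤ z) → ⋁ h ≤ z
    _⊗_     : Carrier → Carrier → Carrier
    I       : Carrier
    [_,_]   : Carrier → Carrier → Carrier
    ⊗-comm  : ∀ x y → x ⊗ y ≡ y ⊗ x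
    ⊗-assoc : ∀ x y z → (x ⊗ y) ⊗ z ≡ x ⊗ (y ⊗ z)
    ⊗-unitˡ : ∀ x → I ⊗ x ≡ x
    ⊗-unitʳ : ∀ x → x ⊗ I ≡ x
    ⊗-⋁ˡ    : ∀ {J : Set ℓ} (h : J → Carrier) (y : Carrier) →
              (⋁ h) ⊗ y ≡ ⋁ (λ j → h j ⊗ y)
    ⊗-⋁ʳ    : ∀ {J : Set ℓ} (x : Carrier) (h : J → Carrier) →
              x ⊗ (⋁ h) ≡ ⋁ (λ j → x ⊗ h j)
    adjunction : ∀ x y z → (x ⊗ y ≤ z) ⇔ (y ≤ [ x , z ])

module _ {c ℓ : Level} (V : Quantale c ℓ) where
  open Quantale V

  private
    ⇒ : ∀ {x y z} → x ⊗ y ≤ z → y ≤ [ x , z ]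
    ⇒ {x} {y} {z} = Equivalence.to (adjunction x y z)
    ⇐ : ∀ {x y z} → y ≤ [ x , z ] → x ⊗ y ≤ z
    ⇐ {x} {y} {z} = Equivalence.from (adjunction x y z)
    ≡⇒≤ : ∀ {x y} → x ≡ y → x ≤ y
    ≡⇒≤ refl = ≤-refl
    monoʳ : ∀ {x y y'} → y ≤ y' → x ⊗ y ≤ x ⊗ y'
    monoʳ p = ⇐ (≤-trans p (⇒ ≤-refl))
    monoˡ : ∀ {x x' y} → x ≤ x' → x ⊗ y ≤ x' ⊗ y
    monoˡ {x} {x'} {y} p =
      ≤-trans (≡⇒≤ (⊗-comm x y)) (≤-trans (monoʳ p) (≡⇒≤ (⊗-comm y x')))
    mono⊗ : ∀ {x x' y y'} → x ≤ x' → y ≤ y' → x ⊗ y ≤ x' ⊗ y'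
    mono⊗ p q = ≤-trans (monoˡ p) (monoʳ q)
    rot : ∀ x y z → x ⊗ (y ⊗ z) ≡ (z ⊗ x) ⊗ y
    rot x y z = trans (cong (x ⊗_) (⊗-comm y z))
                (trans (sym (⊗-assoc x z y)) (cong (_⊗ y) (⊗-comm x z)))
    shuf : ∀ a b c d → (a ⊗ b) ⊗ (c ⊗ d) ≡ (c ⊗ a) ⊗ (b ⊗ d)
    shuf a b c d = begin
        (a ⊗ b) ⊗ (c ⊗ d)  ≡⟨ ⊗-assoc a b (c ⊗ d) ⟩
        a ⊗ (b ⊗ (c ⊗ d))  ≡⟨ cong (a ⊗_) (sym (⊗-assoc b c d)) ⟩
        a ⊗ ((b ⊗ c) ⊗ d)  ≡⟨ cong (λ u → a ⊗ (u ⊗ d)) (⊗-comm b c) ⟩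
        a ⊗ ((c ⊗ b) ⊗ d)  ≡⟨ cong (a ⊗_) (⊗-assoc c b d) ⟩
        a ⊗ (c ⊗ (b ⊗ d))  ≡⟨ sym (⊗-assoc a c (b ⊗ d)) ⟩
        (a ⊗ c) ⊗ (b ⊗ d)  ≡⟨ cong (_⊗ (b ⊗ d)) (⊗-comm a c) ⟩
        (c ⊗ a) ⊗ (b ⊗ d)  ∎
      where open ≡-Reasoning

  record VCat : Set (c ⊔ suc ℓ) where
    field
      Ob   : Set ℓ
      hom  : Ob → Ob → Carrier
      id-≤ : ∀ a → I ≤ hom a a
      comp-≤ : ∀ a b c' → hom b c' ⊗ hom a b ≤ hom a c'
  open VCat public

  record VFun (A B : VCat) : Set (c ⊔ ℓ) where
    field
      fun  : Ob A → Ob B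
      mono : ∀ a a' → hom A a a' ≤ hom B (fun a) (fun a')
  open VFun public

  idF : (A : VCat) → VFun A A
  idF A = record { fun = λ a → a ; mono = λ a a' → ≤-refl }

  _∘F_ : {A B C : VCat} → VFun B C → VFun A B → VFun A C
  _∘F_ {A} {B} {C} g f = record
    { fun  = λ a → fun g (fun f a)
    ; mono = λ a a' → ≤-trans (mono f a a') (mono g (fun f a) (fun f a')) }

  _≤F_ : {A B : VCat} → VFun A B → VFun A B → Set (c ⊔ ℓ)
  _≤F_ {A} {B} f g = ∀ a → I ≤ hom B (fun f a) (fun g a)

  _≡F_ : {A B : VCat} → VFun A B → VFun A B → Set ℓ
  f ≡F g = ∀ a → fun f a ≡ fun g a

  record TwoFunctor : Set (suc (c ⊔ ℓ)) where
    field
      F₀ : VCat → VCat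
      F₁ : {A B : VCat} → VFun A B → VFun (F₀ A) (F₀ B)
      F-id   : (A : VCat) → F₁ (idF A) ≡F idF (F₀ A)
      F-comp : {A B C : VCat} (g : VFun B C) (f : VFun A B) →
               F₁ (g ∘F f) ≡F (F₁ g ∘F F₁ f)
      F-≤    : {A B : VCat} {f g : VFun A B} → f ≤F g → F₁ f ≤F F₁ g
  open TwoFunctor public

  -- Modules R : A ⇝ B, i.e. V-functors B^op ⊗ A → V, written R(b,a).
  -- V-functoriality: (B^op⊗A)((b,a),(b',a')) = B(b',b) ⊗ A(a,a')
  --   ≤ [R(b,a), R(b',a')]  (V being a V-category with hom [-,-]).
  record Mod (A B : VCat) : Set (c ⊔ ℓ) where
    field
      rel  : Ob B → Ob A → Carrier
      func : ∀ b b' a a' →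
             hom B b' b ⊗ hom A a a' ≤ [ rel b a , rel b' a' ]
  open Mod public

  private
    actB : {A B : VCat} (R : Mod A B) → ∀ b b' a →
           rel R b a ⊗ hom B b' b ≤ rel R b' a
    actB {A} {B} R b b' a = ⇐ (≤-trans
      (≤-trans (≡⇒≤ (sym (⊗-unitʳ (hom B b' b)))) (monoʳ (id-≤ A a)))
      (func R b b' a a))
    actA : {A B : VCat} (R : Mod A B) → ∀ b a a' →
           rel R b a ⊗ hom A a a' ≤ rel R b a'
    actA {A} {B} R b a a' = ⇐ (≤-trans
      (≤-trans (≡⇒≤ (sym (⊗-unitˡ (hom A a a')))) (monoˡ (id-≤ B b)))
      (func R b b a a'))

  _◇ : {A B : VCat} → VFun A B → Mod A B
  _◇ {A} {B} f = record
    { rel  = λ b a → hom B b (fun f a)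
    ; func = λ b b' a a' → ⇒ (≤-trans
        (monoʳ (monoʳ (mono f a a')))
        (≤-trans (≡⇒≤ (rot (hom B b (fun f a)) (hom B b' b) (hom B (fun f a) (fun f a'))))
        (≤-trans (monoˡ (comp-≤ B b (fun f a) (fun f a')))
                 (comp-≤ B b' b (fun f a'))))) }

  idM : (A : VCat) → Mod A A
  idM A = idF A ◇

  _·M_ : {A B C : VCat} → Mod B C → Mod A B → Mod A C
  _·M_ {A} {B} {C} S R = record
    { rel  = λ c' a → ⋁ (λ b → rel S c' b ⊗ rel R b a)
    ; func = λ c c' a a' → ⇒ (≤-trans
        (≡⇒≤ (⊗-⋁ˡ (λ b → rel S c b ⊗ rel R b a) (hom C c' c ⊗ hom A a a')))
        (⋁-least _ _ (λ b → ≤-trans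
          (≡⇒≤ (shuf (rel S c b) (rel R b a) (hom C c' c) (hom A a a')))
          (≤-trans (mono⊗ (≤-trans (≡⇒≤ (⊗-comm (hom C c' c) (rel S c b)))
                                  (actB S c c' b))
                         (actA R b a a'))
                   (⋁-upper (λ b₁ → rel S c' b₁ ⊗ rel R b₁ a') b))))) }

  _≤M_ : {A B : VCat} → Mod A B → Mod A B → Set (c ⊔ ℓ)
  _≤M_ {A} {B} R S = ∀ b a → rel R b a ≤ rel S b a

  _≡M_ : {A B : VCat} → Mod A B → Mod A B → Set (c ⊔ ℓ)
  _≡M_ {A} {B} R S = ∀ b a → rel R b a ≡ rel S b a

  -- A 2-functor V-mod → V-mod whose object part is that of T.
  -- (Since (-)_◇ is the identity on objects, the equation
  --  T̄ ∘ (-)_◇ = (-)_◇ ∘ T forces T̄ A = T A on objects.)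
  record ModTwoFunctorOver (T : TwoFunctor) : Set (suc (c ⊔ ℓ)) where
    field
      M₁ : {A B : VCat} → Mod A B → Mod (F₀ T A) (F₀ T B)
      M-id   : (A : VCat) → M₁ (idM A) ≡M idM (F₀ T A)
      M-comp : {A B C : VCat} (S : Mod B C) (R : Mod A B) →
               M₁ (S ·M R) ≡M (M₁ S ·M M₁ R)
      M-≤    : {A B : VCat} {R S : Mod A B} → R ≤M S → M₁ R ≤M M₁ S
  open ModTwoFunctorOver public

  Extends : (T : TwoFunctor) → ModTwoFunctorOver T → Set (c ⊔ suc ℓ)
  Extends T T̄ = {A B : VCat} (f : VFun A B) → M₁ T̄ (f ◇) ≡M (F₁ T f ◇)

  SameModFunctor : {T : TwoFunctor} → ModTwoFunctorOver T → ModTwoFunctorOver T →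
                   Set (c ⊔ suc ℓ)
  SameModFunctor T̄ T̄' = {A B : VCat} (R : Mod A B) → M₁ T̄ R ≡M M₁ T̄' R

  UniqueExtension : TwoFunctor → Set (suc (c ⊔ ℓ))
  UniqueExtension T =
    Σ (ModTwoFunctorOver T) λ T̄ → Extends T T̄ ×
      ((T̄' : ModTwoFunctorOver T) → Extends T T̄' → SameModFunctor T̄ T̄')

  Exact : {P A B C : VCat} → VFun P A → VFun P B → VFun A C → VFun B C → Set (c ⊔ ℓ)
  Exact {P} {A} {B} {C} p₀ p₁ f g =
    ∀ a b → hom C (fun f a) (fun g b)
          ≡ ⋁ (λ (w : Ob P) → hom A a (fun p₀ w) ⊗ hom B (fun p₁ w) b)

  -- (2): Beck–Chevalley condition: T sends exact lax squares to exact
  -- (lax) squares (laxness of the image is automatic, T being a 2-functor).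
  BCC : TwoFunctor → Set (c ⊔ suc ℓ)
  BCC T = {P A B C : VCat} (p₀ : VFun P A) (p₁ : VFun P B)
          (f : VFun A C) (g : VFun B C) →
          (f ∘F p₀) ≤F (g ∘F p₁) → Exact p₀ p₁ f g →
          Exact (F₁ T p₀) (F₁ T p₁) (F₁ T f) (F₁ T g)

-- Every module φ : A ⇝ B is u^◇ · v_◇ for V-functors u, v with u fully
-- faithful, e.g. for the inclusions of B and A into the collage of φ. Under BCC,
-- T̄ φ := (T u)^◇ · (T v)_◇ does not depend on the choice of u, v, because the
-- comparison functor out of the collage sits in an exact square with u; since
-- S · R, identities and graphs all have such representations, T̄ is a 2-functor
-- extending T. Conversely, an extension T̄ preserves the adjunctions f_◇ ⊣ f^◇,
-- so it sends f^◇ to (T f)^◇; hence it is determined by T via collages, and it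
-- maps the equation f^◇ · g_◇ = (p₀)_◇ · (p₁)^◇ expressing exactness of a
-- square to the same equation for the image square.
module Submission where

open import Defs
open import Level using (Level; _⊔_) renaming (suc to lsuc)
open import Function.Bundles using (_⇔_; Equivalence; mk⇔)
open import Relation.Binary.PropositionalEquality using (_≡_; refl; sym; trans; cong; subst; isEquivalence)
open import Relation.Binary.Bundles using (Poset)
open import Data.Product using (_,_)
open import Data.Sum using (_⊎_; inj₁; inj₂)
open import Data.Empty.Polymorphic using (⊥; ⊥-elim)
import Relation.Binary.Reasoning.PartialOrder as PosetReasoning

module _ {c ℓ : Level} (V : Quantale c ℓ) where
  open Quantale V

  ≤-poset : Poset c c c
  ≤-poset = record
    { _≈_ = _≡_
    ; _≤_ = _≤_
    ; isPartialOrder = record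
      { isPreorder = record
        { isEquivalence = isEquivalence
        ; reflexive = λ { refl → ≤-refl }
        ; trans = ≤-trans }
      ; antisym = ≤-antisym } }

  open Poset ≤-poset public using () renaming (reflexive to ≤-reflexive)

  ⊗-monoʳ : ∀ {x y y'} → y ≤ y' → x ⊗ y ≤ x ⊗ y'
  ⊗-monoʳ {x} {y} {y'} y≤y' =
    Equivalence.from (adjunction x y _)
      (≤-trans y≤y' (Equivalence.to (adjunction x y' _) ≤-refl))

  ⊗-monoˡ : ∀ {x x' y} → x ≤ x' → x ⊗ y ≤ x' ⊗ y
  ⊗-monoˡ {x} {x'} {y} x≤x' = begin
    x ⊗ y   ≡⟨ ⊗-comm x y ⟩
    y ⊗ x   ≤⟨ ⊗-monoʳ x≤x' ⟩
    y ⊗ x'  ≡⟨ ⊗-comm y x' ⟩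
    x' ⊗ y  ∎
    where open PosetReasoning ≤-poset

  ⊗-mono : ∀ {x x' y y'} → x ≤ x' → y ≤ y' → x ⊗ y ≤ x' ⊗ y'
  ⊗-mono x≤x' y≤y' = ≤-trans (⊗-monoˡ x≤x') (⊗-monoʳ y≤y')

  I≤-⊗ : ∀ {x y} → I ≤ x → I ≤ y → I ≤ x ⊗ y
  I≤-⊗ I≤x I≤y = ≤-trans (≤-reflexive (sym (⊗-unitˡ I))) (⊗-mono I≤x I≤y)

  ⋁-mono : ∀ {J : Set ℓ} {h k : J → Carrier} → (∀ j → h j ≤ k j) → ⋁ h ≤ ⋁ k
  ⋁-mono {h = h} {k} h≤k = ⋁-least h (⋁ k) (λ j → ≤-trans (h≤k j) (⋁-upper k j))

  bottom : Carrier
  bottom = ⋁ {J = ⊥} ⊥-elim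

  bottom-least : ∀ {z} → bottom ≤ z
  bottom-least {z} = ⋁-least ⊥-elim z ⊥-elim

  ⊗-zeroˡ : ∀ x → bottom ⊗ x ≤ bottom
  ⊗-zeroˡ x = ≤-trans (≤-reflexive (⊗-⋁ˡ ⊥-elim x)) (⋁-least _ bottom ⊥-elim)

  ⊗-zeroʳ : ∀ x → x ⊗ bottom ≤ bottom
  ⊗-zeroʳ x = ≤-trans (≤-reflexive (⊗-⋁ʳ x ⊥-elim)) (⋁-least _ bottom ⊥-elim)

  -- Modules

  rel-actˡ : {A B : VCat V} (R : Mod V A B) → ∀ b b' a →
             rel R b a ⊗ hom B b' b ≤ rel R b' a
  rel-actˡ {A} {B} R b b' a = Equivalence.from (adjunction _ _ _) (begin
    hom B b' b                  ≡⟨ sym (⊗-unitʳ _) ⟩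
    hom B b' b ⊗ I              ≤⟨ ⊗-monoʳ (id-≤ A a) ⟩
    hom B b' b ⊗ hom A a a      ≤⟨ func R b b' a a ⟩
    [ rel R b a , rel R b' a ]  ∎)
    where open PosetReasoning ≤-poset

  rel-actʳ : {A B : VCat V} (R : Mod V A B) → ∀ b a a' →
             rel R b a ⊗ hom A a a' ≤ rel R b a'
  rel-actʳ {A} {B} R b a a' = Equivalence.from (adjunction _ _ _) (begin
    hom A a a'                  ≡⟨ sym (⊗-unitˡ _) ⟩
    I ⊗ hom A a a'              ≤⟨ ⊗-monoˡ (id-≤ B b) ⟩
    hom B b b ⊗ hom A a a'      ≤⟨ func R b b a a' ⟩
    [ rel R b a , rel R b a' ]  ∎)
    where open PosetReasoning ≤-poset

  -- Wrapping _≡M_ and _≤M_ in records lets Agda infer the modules compared.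
  infix 4 _≈_ _⊑_
  record _≈_ {A B : VCat V} (R S : Mod V A B) : Set (c ⊔ ℓ) where
    constructor mk≈
    field un≈ : _≡M_ V R S
  open _≈_ public

  record _⊑_ {A B : VCat V} (R S : Mod V A B) : Set (c ⊔ ℓ) where
    constructor mk⊑
    field un⊑ : _≤M_ V R S
  open _⊑_ public

  ⊑-poset : (A B : VCat V) → Poset (c ⊔ ℓ) (c ⊔ ℓ) (c ⊔ ℓ)
  ⊑-poset A B = record
    { Carrier = Mod V A B
    ; _≈_ = _≈_
    ; _≤_ = _⊑_
    ; isPartialOrder = record
      { isPreorder = record
        { isEquivalence = record
          { refl = mk≈ λ _ _ → refl
          ; sym = λ R≈S → mk≈ λ b a → sym (un≈ R≈S b a)
          ; trans = λ R≈S S≈U → mk≈ λ b a → trans (un≈ R≈S b a) (un≈ S≈U b a) }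
        ; reflexive = λ R≈S → mk⊑ λ b a → ≤-reflexive (un≈ R≈S b a)
        ; trans = λ R⊑S S⊑U → mk⊑ λ b a → ≤-trans (un⊑ R⊑S b a) (un⊑ S⊑U b a) }
      ; antisym = λ R⊑S S⊑R → mk≈ λ b a → ≤-antisym (un⊑ R⊑S b a) (un⊑ S⊑R b a) } }

  module _ {A B : VCat V} where
    open Poset (⊑-poset A B) public using ()
      renaming (reflexive to ≈⇒⊑; trans to ⊑-trans; antisym to ⊑-antisym)
    open Poset.Eq (⊑-poset A B) public using ()
      renaming (sym to ≈-sym; trans to ≈-trans)

    ⊑-refl : {R : Mod V A B} → R ⊑ R
    ⊑-refl = mk⊑ λ _ _ → ≤-refl

    ≈-refl : {R : Mod V A B} → R ≈ R
    ≈-refl = mk≈ λ _ _ → refl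

  module ⊑-Reasoning {A B : VCat V} = PosetReasoning (⊑-poset A B)

  infixr 9 _⊙_
  _⊙_ : {A B C : VCat V} → Mod V B C → Mod V A B → Mod V A C
  _⊙_ = _·M_ V

  ⊙-mono : {A B C : VCat V} {S S' : Mod V B C} {R R' : Mod V A B} →
           S ⊑ S' → R ⊑ R' → S ⊙ R ⊑ S' ⊙ R'
  ⊙-mono S⊑S' R⊑R' = mk⊑ λ c' a → ⋁-mono (λ b → ⊗-mono (un⊑ S⊑S' c' b) (un⊑ R⊑R' b a))

  ⊙-cong : {A B C : VCat V} {S S' : Mod V B C} {R R' : Mod V A B} →
           S ≈ S' → R ≈ R' → S ⊙ R ≈ S' ⊙ R'
  ⊙-cong S≈S' R≈R' = ⊑-antisym (⊙-mono (≈⇒⊑ S≈S') (≈⇒⊑ R≈R'))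
                               (⊙-mono (≈⇒⊑ (≈-sym S≈S')) (≈⇒⊑ (≈-sym R≈R')))

  ⊙-assoc : {A B C D : VCat V} (U : Mod V C D) (S : Mod V B C) (R : Mod V A B) →
            (U ⊙ S) ⊙ R ≈ U ⊙ (S ⊙ R)
  ⊙-assoc U S R = mk≈ λ d a → ≤-antisym (⋁-least _ _ (ltr d a)) (⋁-least _ _ (rtl d a))
    where
    ltr : ∀ d a c' → (⋁ λ b → rel U d b ⊗ rel S b c') ⊗ rel R c' a ≤ rel (U ⊙ (S ⊙ R)) d a
    ltr d a c' = ≤-trans (≤-reflexive (⊗-⋁ˡ _ (rel R c' a)))
      (⋁-least _ _ λ b → ≤-trans (≤-reflexive (⊗-assoc _ _ _))
        (≤-trans (⊗-monoʳ (⋁-upper (λ c₁ → rel S b c₁ ⊗ rel R c₁ a) c'))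
                 (⋁-upper (λ b₁ → rel U d b₁ ⊗ rel (S ⊙ R) b₁ a) b)))
    rtl : ∀ d a b → rel U d b ⊗ (⋁ λ c' → rel S b c' ⊗ rel R c' a) ≤ rel ((U ⊙ S) ⊙ R) d a
    rtl d a b = ≤-trans (≤-reflexive (⊗-⋁ʳ (rel U d b) _))
      (⋁-least _ _ λ c' → ≤-trans (≤-reflexive (sym (⊗-assoc _ _ _)))
        (≤-trans (⊗-monoˡ (⋁-upper (λ b₁ → rel U d b₁ ⊗ rel S b₁ c') b))
                 (⋁-upper (λ c₁ → rel (U ⊙ S) d c₁ ⊗ rel R c₁ a) c')))

  ⊙-identityˡ : {A B : VCat V} (R : Mod V A B) → idM V B ⊙ R ≈ R
  ⊙-identityˡ {A} {B} R = mk≈ λ b a → ≤-antisym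
    (⋁-least _ _ λ b' → ≤-trans (≤-reflexive (⊗-comm _ _)) (rel-actˡ R b' b a))
    (≤-trans (≤-reflexive (sym (⊗-unitˡ _)))
      (≤-trans (⊗-monoˡ (id-≤ B b)) (⋁-upper (λ b' → hom B b b' ⊗ rel R b' a) b)))

  ⊙-identityʳ : {A B : VCat V} (R : Mod V A B) → R ⊙ idM V A ≈ R
  ⊙-identityʳ {A} {B} R = mk≈ λ b a → ≤-antisym
    (⋁-least _ _ λ a' → rel-actʳ R b a' a)
    (≤-trans (≤-reflexive (sym (⊗-unitʳ _)))
      (≤-trans (⊗-monoʳ (id-≤ A a)) (⋁-upper (λ a' → rel R b a' ⊗ hom A a' a) a)))

  ⊙-mono-middle : {A B B₁ B₂ C D : VCat V} {X : Mod V C D} {W : Mod V A B}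
                  {Y₁ : Mod V B₁ C} {Z₁ : Mod V B₂ C} {Y₂ : Mod V B B₁} {Z₂ : Mod V B B₂} →
                  Y₁ ⊙ Y₂ ⊑ Z₁ ⊙ Z₂ → (X ⊙ Y₁) ⊙ (Y₂ ⊙ W) ⊑ (X ⊙ Z₁) ⊙ (Z₂ ⊙ W)
  ⊙-mono-middle {X = X} {W} {Y₁} {Z₁} {Y₂} {Z₂} Y⊑Z = begin
    (X ⊙ Y₁) ⊙ (Y₂ ⊙ W)  ≈⟨ ⊙-assoc X Y₁ (Y₂ ⊙ W) ⟩
    X ⊙ (Y₁ ⊙ (Y₂ ⊙ W))  ≈⟨ ⊙-cong (≈-refl {R = X}) (⊙-assoc Y₁ Y₂ W) ⟨
    X ⊙ ((Y₁ ⊙ Y₂) ⊙ W)  ≤⟨ ⊙-mono (⊑-refl {R = X}) (⊙-mono Y⊑Z (⊑-refl {R = W})) ⟩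
    X ⊙ ((Z₁ ⊙ Z₂) ⊙ W)  ≈⟨ ⊙-cong (≈-refl {R = X}) (⊙-assoc Z₁ Z₂ W) ⟩
    X ⊙ (Z₁ ⊙ (Z₂ ⊙ W))  ≈⟨ ⊙-assoc X Z₁ (Z₂ ⊙ W) ⟨
    (X ⊙ Z₁) ⊙ (Z₂ ⊙ W)  ∎
    where open ⊑-Reasoning

  ⊙-cong-middle : {A B B₁ B₂ C D : VCat V} {X : Mod V C D} {W : Mod V A B}
                  {Y₁ : Mod V B₁ C} {Z₁ : Mod V B₂ C} {Y₂ : Mod V B B₁} {Z₂ : Mod V B B₂} →
                  Y₁ ⊙ Y₂ ≈ Z₁ ⊙ Z₂ → (X ⊙ Y₁) ⊙ (Y₂ ⊙ W) ≈ (X ⊙ Z₁) ⊙ (Z₂ ⊙ W)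
  ⊙-cong-middle {X = X} {W} {Y₁} {Z₁} {Y₂} {Z₂} Y≈Z =
    ⊑-antisym (⊙-mono-middle {X = X} {W} {Y₁} {Z₁} {Y₂} {Z₂} (≈⇒⊑ Y≈Z))
              (⊙-mono-middle {X = X} {W} {Z₁} {Y₁} {Z₂} {Y₂} (≈⇒⊑ (≈-sym Y≈Z)))

  -- Graphs, cographs and exact squares

  graph : {A B : VCat V} → VFun V A B → Mod V A B
  graph f = _◇ V f

  cograph : {A B : VCat V} → VFun V A B → Mod V B A
  cograph {A} {B} f = record
    { rel = λ a b → hom B (fun f a) b
    ; func = λ a a' b b' → Equivalence.to (adjunction _ _ _) (begin
        hom B (fun f a) b ⊗ (hom A a' a ⊗ hom B b b')
          ≤⟨ ⊗-monoʳ (⊗-monoˡ (mono f a' a)) ⟩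
        hom B (fun f a) b ⊗ (hom B (fun f a') (fun f a) ⊗ hom B b b')
          ≡⟨ sym (⊗-assoc _ _ _) ⟩
        (hom B (fun f a) b ⊗ hom B (fun f a') (fun f a)) ⊗ hom B b b'
          ≡⟨ ⊗-comm _ _ ⟩
        hom B b b' ⊗ (hom B (fun f a) b ⊗ hom B (fun f a') (fun f a))
          ≤⟨ ⊗-monoʳ (comp-≤ B (fun f a') (fun f a) b) ⟩
        hom B b b' ⊗ hom B (fun f a') b
          ≤⟨ comp-≤ B (fun f a') b b' ⟩
        hom B (fun f a') b' ∎) }
    where open PosetReasoning ≤-poset

  cograph⊙graph : {A B C : VCat V} (f : VFun V A C) (g : VFun V B C) →
                  ∀ a b → rel (cograph f ⊙ graph g) a b ≡ hom C (fun f a) (fun g b)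
  cograph⊙graph {C = C} f g a b = un≈ (⊙-identityˡ (idM V C)) (fun f a) (fun g b)

  graph-∘ : {A B C : VCat V} (g : VFun V B C) (f : VFun V A B) →
            graph (_∘F_ V g f) ≈ graph g ⊙ graph f
  graph-∘ g f = mk≈ λ c' a → sym (un≈ (⊙-identityʳ (graph g)) c' (fun f a))

  cograph-∘ : {A B C : VCat V} (g : VFun V B C) (f : VFun V A B) →
              cograph (_∘F_ V g f) ≈ cograph f ⊙ cograph g
  cograph-∘ g f = mk≈ λ a c' → sym (un≈ (⊙-identityˡ (cograph g)) (fun f a) c')

  cograph-id : (A : VCat V) → cograph (idF V A) ≈ idM V A
  cograph-id A = mk≈ λ _ _ → refl

  graph-cong : {A B : VCat V} {f g : VFun V A B} → _≡F_ V f g → graph f ≈ graph g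
  graph-cong {B = B} f≡g = mk≈ λ b a → cong (hom B b) (f≡g a)

  cograph-cong : {A B : VCat V} {f g : VFun V A B} → _≡F_ V f g → cograph f ≈ cograph g
  cograph-cong {B = B} f≡g = mk≈ λ a b → cong (λ x → hom B x b) (f≡g a)

  graph-mono : {A B : VCat V} {f g : VFun V A B} → _≤F_ V f g → graph f ⊑ graph g
  graph-mono {B = B} {f} {g} f≤g = mk⊑ λ b a →
    ≤-trans (≤-reflexive (sym (⊗-unitˡ _)))
      (≤-trans (⊗-monoˡ (f≤g a)) (comp-≤ B b (fun f a) (fun g a)))

  cograph-antitone : {A B : VCat V} {f g : VFun V A B} → _≤F_ V f g → cograph g ⊑ cograph f
  cograph-antitone {B = B} {f} {g} f≤g = mk⊑ λ a b →
    ≤-trans (≤-reflexive (sym (⊗-unitʳ _)))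
      (≤-trans (⊗-monoʳ (f≤g a)) (comp-≤ B (fun f a) (fun g a) b))

  ≡F⇒≤F : {A B : VCat V} {f g : VFun V A B} → _≡F_ V f g → _≤F_ V f g
  ≡F⇒≤F {B = B} {f} f≡g a = subst (λ x → I ≤ hom B (fun f a) x) (f≡g a) (id-≤ B (fun f a))

  Exact⇔cograph⊙graph : {P A B C : VCat V} (p₀ : VFun V P A) (p₁ : VFun V P B)
                        (f : VFun V A C) (g : VFun V B C) →
                        Exact V p₀ p₁ f g ⇔ (cograph f ⊙ graph g ≈ graph p₀ ⊙ cograph p₁)
  Exact⇔cograph⊙graph p₀ p₁ f g = mk⇔
    (λ exact → mk≈ λ a b → trans (cograph⊙graph f g a b) (exact a b))
    (λ square a b → trans (sym (cograph⊙graph f g a b)) (un≈ square a b))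

  infix 4 _⊣_
  record _⊣_ {A B : VCat V} (L : Mod V A B) (R : Mod V B A) : Set (c ⊔ ℓ) where
    field
      unit   : idM V A ⊑ R ⊙ L
      counit : L ⊙ R ⊑ idM V B
  open _⊣_ public

  graph⊣cograph : {A B : VCat V} (f : VFun V A B) → graph f ⊣ cograph f
  graph⊣cograph {A} {B} f = record
    { unit = mk⊑ λ a a' →
        ≤-trans (mono f a a') (≤-reflexive (sym (cograph⊙graph f f a a')))
    ; counit = mk⊑ λ b b' →
        ⋁-least _ _ λ a → ≤-trans (≤-reflexive (⊗-comm _ _)) (comp-≤ B b (fun f a) b') }

  ⊣-respˡ : {A B : VCat V} {L L' : Mod V A B} {R : Mod V B A} → L ≈ L' → L ⊣ R → L' ⊣ R
  ⊣-respˡ {R = R} L≈L' L⊣R = record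
    { unit = ⊑-trans (unit L⊣R) (⊙-mono (⊑-refl {R = R}) (≈⇒⊑ L≈L'))
    ; counit = ⊑-trans (⊙-mono (≈⇒⊑ (≈-sym L≈L')) (⊑-refl {R = R})) (counit L⊣R) }

  right-adjoint-≤ : {A B : VCat V} {L : Mod V A B} {R R' : Mod V B A} →
                    L ⊣ R → L ⊣ R' → R ⊑ R'
  right-adjoint-≤ {L = L} {R} {R'} L⊣R L⊣R' = begin
    R                ≈⟨ ⊙-identityˡ R ⟨
    idM V _ ⊙ R      ≤⟨ ⊙-mono (unit L⊣R') (⊑-refl {R = R}) ⟩
    (R' ⊙ L) ⊙ R     ≈⟨ ⊙-assoc R' L R ⟩
    R' ⊙ (L ⊙ R)     ≤⟨ ⊙-mono (⊑-refl {R = R'}) (counit L⊣R) ⟩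
    R' ⊙ idM V _     ≈⟨ ⊙-identityʳ R' ⟩
    R'               ∎
    where open ⊑-Reasoning

  right-adjoint-unique : {A B : VCat V} {L : Mod V A B} {R R' : Mod V B A} →
                         L ⊣ R → L ⊣ R' → R ≈ R'
  right-adjoint-unique L⊣R L⊣R' =
    ⊑-antisym (right-adjoint-≤ L⊣R L⊣R') (right-adjoint-≤ L⊣R' L⊣R)

  -- Collages

  module _ {A B : VCat V} (φ : Mod V A B) where

    collage-hom : Ob A ⊎ Ob B → Ob A ⊎ Ob B → Carrier
    collage-hom (inj₁ a) (inj₁ a') = hom A a a'
    collage-hom (inj₂ b) (inj₂ b') = hom B b b'
    collage-hom (inj₂ b) (inj₁ a)  = rel φ b a
    collage-hom (inj₁ a) (inj₂ b)  = bottom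

    collage-id : ∀ x → I ≤ collage-hom x x
    collage-id (inj₁ a) = id-≤ A a
    collage-id (inj₂ b) = id-≤ B b

    collage-comp : ∀ x y z → collage-hom y z ⊗ collage-hom x y ≤ collage-hom x z
    collage-comp (inj₁ a) (inj₁ a') (inj₁ a'') = comp-≤ A a a' a''
    collage-comp (inj₁ a) (inj₁ a') (inj₂ b)   = ≤-trans (⊗-zeroˡ _) bottom-least
    collage-comp (inj₁ a) (inj₂ b)  z          = ≤-trans (⊗-zeroʳ _) bottom-least
    collage-comp (inj₂ b) (inj₁ a)  (inj₁ a')  =
      ≤-trans (≤-reflexive (⊗-comm _ _)) (rel-actʳ φ b a a')
    collage-comp (inj₂ b) (inj₁ a)  (inj₂ b')  = ≤-trans (⊗-zeroˡ _) bottom-least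
    collage-comp (inj₂ b) (inj₂ b') (inj₁ a)   = rel-actˡ φ b' b a
    collage-comp (inj₂ b) (inj₂ b') (inj₂ b'') = comp-≤ B b b' b''

    Collage : VCat V
    Collage = record
      { Ob = Ob A ⊎ Ob B ; hom = collage-hom ; id-≤ = collage-id ; comp-≤ = collage-comp }

    ιA : VFun V A Collage
    ιA = record { fun = inj₁ ; mono = λ _ _ → ≤-refl }

    ιB : VFun V B Collage
    ιB = record { fun = inj₂ ; mono = λ _ _ → ≤-refl }

    collage-copair : {D : VCat V} (u : VFun V B D) (v : VFun V A D) →
                     (∀ b a → rel φ b a ≤ hom D (fun u b) (fun v a)) → VFun V Collage D
    collage-copair {D} u v φ≤uv = record { fun = copair ; mono = copair-mono }
      where
      copair : Ob A ⊎ Ob B → Ob D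
      copair (inj₁ a) = fun v a
      copair (inj₂ b) = fun u b
      copair-mono : ∀ x y → collage-hom x y ≤ hom D (copair x) (copair y)
      copair-mono (inj₁ a) (inj₁ a') = mono v a a'
      copair-mono (inj₁ a) (inj₂ b)  = bottom-least
      copair-mono (inj₂ b) (inj₁ a)  = φ≤uv b a
      copair-mono (inj₂ b) (inj₂ b') = mono u b b'

  collage-map : {A B : VCat V} {φ ψ : Mod V A B} → φ ⊑ ψ → VFun V (Collage φ) (Collage ψ)
  collage-map {φ = φ} {ψ} φ⊑ψ = record { fun = λ x → x ; mono = map-mono }
    where
    map-mono : ∀ x y → collage-hom φ x y ≤ collage-hom ψ x y
    map-mono (inj₁ a) (inj₁ a') = ≤-refl
    map-mono (inj₁ a) (inj₂ b)  = ≤-refl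
    map-mono (inj₂ b) (inj₁ a)  = un⊑ φ⊑ψ b a
    map-mono (inj₂ b) (inj₂ b') = ≤-refl

  cograph⊙graph-collage : {A B : VCat V} (φ : Mod V A B) →
                          φ ≈ cograph (ιB φ) ⊙ graph (ιA φ)
  cograph⊙graph-collage φ = mk≈ λ b a → sym (cograph⊙graph (ιB φ) (ιA φ) b a)

  record Representation {A B : VCat V} (φ : Mod V A B) : Set (c ⊔ lsuc ℓ) where
    field
      D : VCat V
      u : VFun V B D
      v : VFun V A D
      u-fully-faithful : ∀ b b' → hom D (fun u b) (fun u b') ≡ hom B b b'
      represents : ∀ b a → hom D (fun u b) (fun v a) ≡ rel φ b a

    comparison : VFun V (Collage φ) D
    comparison = collage-copair φ u v λ b a → ≤-reflexive (sym (represents b a))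

    comparison-square-exact : Exact V (idF V B) (ιB φ) u comparison
    comparison-square-exact b y = trans (u-vs-comparison y)
                                        (sym (un≈ (⊙-identityˡ (cograph (ιB φ))) b y))
      where
      u-vs-comparison : ∀ y → hom D (fun u b) (fun comparison y) ≡ collage-hom φ (inj₂ b) y
      u-vs-comparison (inj₁ a)  = represents b a
      u-vs-comparison (inj₂ b') = u-fully-faithful b b'
  open Representation public

  identity-representation : (A : VCat V) → Representation (idM V A)
  identity-representation A = record
    { D = A ; u = idF V A ; v = idF V A
    ; u-fully-faithful = λ _ _ → refl ; represents = λ _ _ → refl }

  graph-representation : {A B : VCat V} (f : VFun V A B) → Representation (graph f)
  graph-representation {B = B} f = record
    { D = B ; u = idF V B ; v = f
    ; u-fully-faithful = λ _ _ → refl ; represents = λ _ _ → refl }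

  -- Collage₂ S R glues Collage R and Collage S along B; this is the collage of
  -- the composable pair R, S.
  module _ {A B C : VCat V} (S : Mod V B C) (R : Mod V A B) where

    Collage₂ : VCat V
    Collage₂ = Collage (graph (ιA S) ⊙ cograph (ιB R))

    ιS : VFun V (Collage S) Collage₂
    ιS = ιB (graph (ιA S) ⊙ cograph (ιB R))

    ιR : VFun V (Collage R) Collage₂
    ιR = ιA (graph (ιA S) ⊙ cograph (ιB R))

    Collage₂-square-lax : _≤F_ V (_∘F_ V ιS (ιA S)) (_∘F_ V ιR (ιB R))
    Collage₂-square-lax b =
      ≤-trans (I≤-⊗ (id-≤ B b) (id-≤ B b)) (⋁-upper (λ b' → hom B b b' ⊗ hom B b' b) b)

    Collage₂-square-exact : Exact V (ιA S) (ιB R) ιS ιR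
    Collage₂-square-exact _ _ = refl

    ⊙-representation : Representation (S ⊙ R)
    ⊙-representation = record
      { D = Collage₂ ; u = _∘F_ V ιS (ιB S) ; v = _∘F_ V ιR (ιA R)
      ; u-fully-faithful = λ _ _ → refl ; represents = λ _ _ → refl }

  -- Extending a 2-functor along (-)_◇

  module _ (T : TwoFunctor V) where

    T₁ : {A B : VCat V} → VFun V A B → VFun V (F₀ T A) (F₀ T B)
    T₁ = F₁ T

    -- T₁ preserves _≤F_ but not _≡F_, hence the detour through antisymmetry.
    graph-T-cong : {A B : VCat V} {f g : VFun V A B} → _≡F_ V f g →
                   graph (T₁ f) ≈ graph (T₁ g)
    graph-T-cong {f = f} {g} f≡g = ⊑-antisym
      (graph-mono (F-≤ T {f = f} {g} (≡F⇒≤F {f = f} {g} f≡g)))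
      (graph-mono (F-≤ T {f = g} {f} (≡F⇒≤F {f = g} {f} λ a → sym (f≡g a))))

    cograph-T-cong : {A B : VCat V} {f g : VFun V A B} → _≡F_ V f g →
                     cograph (T₁ f) ≈ cograph (T₁ g)
    cograph-T-cong {f = f} {g} f≡g = ⊑-antisym
      (cograph-antitone (F-≤ T {f = g} {f} (≡F⇒≤F {f = g} {f} λ a → sym (f≡g a))))
      (cograph-antitone (F-≤ T {f = f} {g} (≡F⇒≤F {f = f} {g} f≡g)))

    graph-T-∘ : {A B C : VCat V} (g : VFun V B C) (f : VFun V A B) →
                graph (T₁ (_∘F_ V g f)) ≈ graph (T₁ g) ⊙ graph (T₁ f)
    graph-T-∘ g f = ≈-trans (graph-cong (F-comp T g f)) (graph-∘ (T₁ g) (T₁ f))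

    cograph-T-∘ : {A B C : VCat V} (g : VFun V B C) (f : VFun V A B) →
                  cograph (T₁ (_∘F_ V g f)) ≈ cograph (T₁ f) ⊙ cograph (T₁ g)
    cograph-T-∘ g f = ≈-trans (cograph-cong (F-comp T g f)) (cograph-∘ (T₁ g) (T₁ f))

    graph-T-id : (A : VCat V) → graph (T₁ (idF V A)) ≈ idM V (F₀ T A)
    graph-T-id A = graph-cong (F-id T A)

    cograph-T-id : (A : VCat V) → cograph (T₁ (idF V A)) ≈ idM V (F₀ T A)
    cograph-T-id A = ≈-trans (cograph-cong (F-id T A)) (cograph-id (F₀ T A))

    extend : {A B : VCat V} → Mod V A B → Mod V (F₀ T A) (F₀ T B)
    extend φ = cograph (T₁ (ιB φ)) ⊙ graph (T₁ (ιA φ))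

    extend-mono : {A B : VCat V} {φ ψ : Mod V A B} → φ ⊑ ψ → extend φ ⊑ extend ψ
    extend-mono {φ = φ} {ψ} φ⊑ψ = begin
      extend φ
        ≈⟨ ⊙-cong (⊙-identityʳ (cograph (T₁ (ιB φ)))) (⊙-identityˡ (graph (T₁ (ιA φ)))) ⟨
      (cograph (T₁ (ιB φ)) ⊙ idM V _) ⊙ (idM V _ ⊙ graph (T₁ (ιA φ)))
        ≤⟨ ⊙-mono-middle {X = cograph (T₁ (ιB φ))} {graph (T₁ (ιA φ))}
             {idM V _} {cograph (T₁ h)} {idM V _} {graph (T₁ h)}
             (⊑-trans (≈⇒⊑ (⊙-identityˡ (idM V _))) (unit (graph⊣cograph (T₁ h)))) ⟩
      (cograph (T₁ (ιB φ)) ⊙ cograph (T₁ h)) ⊙ (graph (T₁ h) ⊙ graph (T₁ (ιA φ)))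
        ≈⟨ ⊙-cong (cograph-T-∘ h (ιB φ)) (graph-T-∘ h (ιA φ)) ⟨
      cograph (T₁ (_∘F_ V h (ιB φ))) ⊙ graph (T₁ (_∘F_ V h (ιA φ)))
        ≈⟨ ⊙-cong (cograph-T-cong {f = _∘F_ V h (ιB φ)} {ιB ψ} λ _ → refl)
                  (graph-T-cong {f = _∘F_ V h (ιA φ)} {ιA ψ} λ _ → refl) ⟩
      extend ψ ∎
      where
      open ⊑-Reasoning
      h : VFun V (Collage φ) (Collage ψ)
      h = collage-map φ⊑ψ

    module _ (bcc : BCC V T) where

      BCC⇒cograph⊙graph : {P A B C : VCat V} (p₀ : VFun V P A) (p₁ : VFun V P B)
                          (f : VFun V A C) (g : VFun V B C) →
                          _≤F_ V (_∘F_ V f p₀) (_∘F_ V g p₁) → Exact V p₀ p₁ f g →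
                          cograph (T₁ f) ⊙ graph (T₁ g) ≈ graph (T₁ p₀) ⊙ cograph (T₁ p₁)
      BCC⇒cograph⊙graph p₀ p₁ f g lax exact =
        Equivalence.to (Exact⇔cograph⊙graph (T₁ p₀) (T₁ p₁) (T₁ f) (T₁ g)) (bcc p₀ p₁ f g lax exact)

      extend-representation : {A B : VCat V} {φ : Mod V A B} (ρ : Representation φ) →
                              extend φ ≈ cograph (T₁ (u ρ)) ⊙ graph (T₁ (v ρ))
      extend-representation {B = B} {φ} ρ = begin-equality
        cograph (T₁ (ιB φ)) ⊙ graph (T₁ (ιA φ))
          ≈⟨ ⊙-cong u*h*≈ιB* (≈-refl {R = graph (T₁ (ιA φ))}) ⟨
        (cograph (T₁ (u ρ)) ⊙ graph (T₁ h)) ⊙ graph (T₁ (ιA φ))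
          ≈⟨ ⊙-assoc (cograph (T₁ (u ρ))) (graph (T₁ h)) (graph (T₁ (ιA φ))) ⟩
        cograph (T₁ (u ρ)) ⊙ (graph (T₁ h) ⊙ graph (T₁ (ιA φ)))
          ≈⟨ ⊙-cong (≈-refl {R = cograph (T₁ (u ρ))}) (graph-T-∘ h (ιA φ)) ⟨
        cograph (T₁ (u ρ)) ⊙ graph (T₁ (_∘F_ V h (ιA φ)))
          ≈⟨ ⊙-cong (≈-refl {R = cograph (T₁ (u ρ))})
                    (graph-T-cong {f = _∘F_ V h (ιA φ)} {v ρ} λ _ → refl) ⟩
        cograph (T₁ (u ρ)) ⊙ graph (T₁ (v ρ)) ∎
        where
        open ⊑-Reasoning
        h : VFun V (Collage φ) (D ρ)
        h = comparison ρ
        u*h*≈ιB* : cograph (T₁ (u ρ)) ⊙ graph (T₁ h) ≈ cograph (T₁ (ιB φ))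
        u*h*≈ιB* = begin-equality
          cograph (T₁ (u ρ)) ⊙ graph (T₁ h)
            ≈⟨ BCC⇒cograph⊙graph (idF V B) (ιB φ) (u ρ) h
                 (λ b → id-≤ (D ρ) (fun (u ρ) b)) (comparison-square-exact ρ) ⟩
          graph (T₁ (idF V B)) ⊙ cograph (T₁ (ιB φ))
            ≈⟨ ⊙-cong (graph-T-id B) (≈-refl {R = cograph (T₁ (ιB φ))}) ⟩
          idM V (F₀ T B) ⊙ cograph (T₁ (ιB φ))
            ≈⟨ ⊙-identityˡ (cograph (T₁ (ιB φ))) ⟩
          cograph (T₁ (ιB φ)) ∎

      extend-⊙ : {A B C : VCat V} (S : Mod V B C) (R : Mod V A B) →
                 extend (S ⊙ R) ≈ extend S ⊙ extend R
      extend-⊙ S R = begin-equality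
        extend (S ⊙ R)
          ≈⟨ extend-representation (⊙-representation S R) ⟩
        cograph (T₁ (_∘F_ V (ιS S R) (ιB S))) ⊙ graph (T₁ (_∘F_ V (ιR S R) (ιA R)))
          ≈⟨ ⊙-cong (cograph-T-∘ (ιS S R) (ιB S)) (graph-T-∘ (ιR S R) (ιA R)) ⟩
        (cograph (T₁ (ιB S)) ⊙ cograph (T₁ (ιS S R))) ⊙ (graph (T₁ (ιR S R)) ⊙ graph (T₁ (ιA R)))
          ≈⟨ ⊙-cong-middle {X = cograph (T₁ (ιB S))} {graph (T₁ (ιA R))}
               {cograph (T₁ (ιS S R))} {graph (T₁ (ιA S))} {graph (T₁ (ιR S R))} {cograph (T₁ (ιB R))}
               (BCC⇒cograph⊙graph (ιA S) (ιB R) (ιS S R) (ιR S R)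
                  (Collage₂-square-lax S R) (Collage₂-square-exact S R)) ⟩
        extend S ⊙ extend R ∎
        where open ⊑-Reasoning

      extend-id : (A : VCat V) → extend (idM V A) ≈ idM V (F₀ T A)
      extend-id A = begin-equality
        extend (idM V A)
          ≈⟨ extend-representation (identity-representation A) ⟩
        cograph (T₁ (idF V A)) ⊙ graph (T₁ (idF V A))
          ≈⟨ ⊙-cong (cograph-T-id A) (graph-T-id A) ⟩
        idM V (F₀ T A) ⊙ idM V (F₀ T A)
          ≈⟨ ⊙-identityˡ (idM V (F₀ T A)) ⟩
        idM V (F₀ T A) ∎
        where open ⊑-Reasoning

      extend-graph : {A B : VCat V} (f : VFun V A B) → extend (graph f) ≈ graph (T₁ f)
      extend-graph {B = B} f = begin-equality
        extend (graph f)
          ≈⟨ extend-representation (graph-representation f) ⟩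
        cograph (T₁ (idF V B)) ⊙ graph (T₁ f)
          ≈⟨ ⊙-cong (cograph-T-id B) (≈-refl {R = graph (T₁ f)}) ⟩
        idM V (F₀ T B) ⊙ graph (T₁ f)
          ≈⟨ ⊙-identityˡ (graph (T₁ f)) ⟩
        graph (T₁ f) ∎
        where open ⊑-Reasoning

      collage-extension : ModTwoFunctorOver V T
      collage-extension = record
        { M₁ = extend
        ; M-id = λ A → un≈ (extend-id A)
        ; M-comp = λ S R → un≈ (extend-⊙ S R)
        ; M-≤ = λ φ≤ψ → un⊑ (extend-mono (mk⊑ φ≤ψ)) }

    module _ (T̄ : ModTwoFunctorOver V T) where

      M₁-mono : {A B : VCat V} {R S : Mod V A B} → R ⊑ S → M₁ T̄ R ⊑ M₁ T̄ S
      M₁-mono {R = R} {S} R⊑S = mk⊑ (M-≤ T̄ {R = R} {S} (un⊑ R⊑S))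

      M₁-cong : {A B : VCat V} {R S : Mod V A B} → R ≈ S → M₁ T̄ R ≈ M₁ T̄ S
      M₁-cong R≈S = ⊑-antisym (M₁-mono (≈⇒⊑ R≈S)) (M₁-mono (≈⇒⊑ (≈-sym R≈S)))

      M₁-⊙ : {A B C : VCat V} (S : Mod V B C) (R : Mod V A B) →
             M₁ T̄ (S ⊙ R) ≈ M₁ T̄ S ⊙ M₁ T̄ R
      M₁-⊙ S R = mk≈ (M-comp T̄ S R)

      M₁-preserves-⊣ : {A B : VCat V} {L : Mod V A B} {R : Mod V B A} →
                       L ⊣ R → M₁ T̄ L ⊣ M₁ T̄ R
      M₁-preserves-⊣ {A} {B} {L} {R} L⊣R = record
        { unit = begin
            idM V (F₀ T A)        ≈⟨ mk≈ (M-id T̄ A) ⟨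
            M₁ T̄ (idM V A)        ≤⟨ M₁-mono (unit L⊣R) ⟩
            M₁ T̄ (R ⊙ L)          ≈⟨ M₁-⊙ R L ⟩
            M₁ T̄ R ⊙ M₁ T̄ L       ∎
        ; counit = begin
            M₁ T̄ L ⊙ M₁ T̄ R       ≈⟨ M₁-⊙ L R ⟨
            M₁ T̄ (L ⊙ R)          ≤⟨ M₁-mono (counit L⊣R) ⟩
            M₁ T̄ (idM V B)        ≈⟨ mk≈ (M-id T̄ B) ⟩
            idM V (F₀ T B)        ∎ }
        where open ⊑-Reasoning

      module _ (extends : Extends V T T̄) where

        extension-graph : {A B : VCat V} (f : VFun V A B) → M₁ T̄ (graph f) ≈ graph (T₁ f)
        extension-graph f = mk≈ (extends f)

        extension-cograph : {A B : VCat V} (f : VFun V A B) → M₁ T̄ (cograph f) ≈ cograph (T₁ f)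
        extension-cograph f = right-adjoint-unique
          (⊣-respˡ (extension-graph f) (M₁-preserves-⊣ (graph⊣cograph f)))
          (graph⊣cograph (T₁ f))

        extension-determined : {A B : VCat V} (φ : Mod V A B) → M₁ T̄ φ ≈ extend φ
        extension-determined φ = begin-equality
          M₁ T̄ φ
            ≈⟨ M₁-cong (cograph⊙graph-collage φ) ⟩
          M₁ T̄ (cograph (ιB φ) ⊙ graph (ιA φ))
            ≈⟨ M₁-⊙ (cograph (ιB φ)) (graph (ιA φ)) ⟩
          M₁ T̄ (cograph (ιB φ)) ⊙ M₁ T̄ (graph (ιA φ))
            ≈⟨ ⊙-cong (extension-cograph (ιB φ)) (extension-graph (ιA φ)) ⟩
          extend φ ∎
          where open ⊑-Reasoning

        extension-BCC : BCC V T
        extension-BCC p₀ p₁ f g _ exact =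
          Equivalence.from (Exact⇔cograph⊙graph (T₁ p₀) (T₁ p₁) (T₁ f) (T₁ g)) (begin-equality
            cograph (T₁ f) ⊙ graph (T₁ g)
              ≈⟨ ⊙-cong (extension-cograph f) (extension-graph g) ⟨
            M₁ T̄ (cograph f) ⊙ M₁ T̄ (graph g)
              ≈⟨ M₁-⊙ (cograph f) (graph g) ⟨
            M₁ T̄ (cograph f ⊙ graph g)
              ≈⟨ M₁-cong (Equivalence.to (Exact⇔cograph⊙graph p₀ p₁ f g) exact) ⟩
            M₁ T̄ (graph p₀ ⊙ cograph p₁)
              ≈⟨ M₁-⊙ (graph p₀) (cograph p₁) ⟩
            M₁ T̄ (graph p₀) ⊙ M₁ T̄ (cograph p₁)
              ≈⟨ ⊙-cong (extension-graph p₀) (extension-cograph p₁) ⟩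
            graph (T₁ p₀) ⊙ cograph (T₁ p₁) ∎)
          where open ⊑-Reasoning

corollary5p11 : {c ℓ : Level} (V : Quantale c ℓ) (T : TwoFunctor V) →
                UniqueExtension V T ⇔ BCC V T
corollary5p11 V T = mk⇔ unique-extension⇒BCC BCC⇒unique-extension
  where
  unique-extension⇒BCC : UniqueExtension V T → BCC V T
  unique-extension⇒BCC (T̄ , extends , _) = extension-BCC V T T̄ extends

  BCC⇒unique-extension : BCC V T → UniqueExtension V T
  BCC⇒unique-extension bcc =
    collage-extension V T bcc ,
    (λ f → un≈ (extend-graph V T bcc f)) ,
    (λ T̄ extends φ → un≈ (≈-sym V (extension-determined V T T̄ extends φ)))
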